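{- No bipartite graph that contains neither $P_7$ nor $C_4$ as an induced subgraph contains $P_9$ as a (not necessarily induced) subgraph.
   Context: All graphs are finite, simple and undirected. $P_k$ denotes the path on $k$ vertices and $C_4$ the cycle on 4 vertices. A subgraph is obtained by deleting vertices and edges; an induced subgraph by deleting vertices only. -}

module Defs where

open import Data.Nat using (ℕ; suc)
open import Data.Fin using (Fin; toℕ)
open import Data.Bool using (Bool)
open import Data.Product using (Σ; _×_)
open import Data.Sum using (_⊎_)
open import Data.Empty using (⊥)
open import Relation.Nullary using (¬_)
open import Relation.Binary.PropositionalEquality using (_≡_; _≢_)
open import Function using (_⇔_)
open import Function.Definitions using (Injective)

record Graph (n : ℕ) : Set₁ where
  field
    Adj   : Fin n → Fin n → Set
    sym   : ∀ {u v} → Adj u v → Adj v u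
    irrefl : ∀ {u} → ¬ Adj u u
open Graph public

Bipartite : ∀ {n} → Graph n → Set
Bipartite {n} G = Σ (Fin n → Bool) λ c → ∀ {u v} → Adj G u v → c u ≢ c v

PathAdj : ∀ {k} → Fin k → Fin k → Set
PathAdj i j = (toℕ j ≡ suc (toℕ i)) ⊎ (toℕ i ≡ suc (toℕ j))

C4Adj : Fin 4 → Fin 4 → Set
C4Adj i j = PathAdj i j ⊎ ((toℕ i ≡ 0 × toℕ j ≡ 3) ⊎ (toℕ i ≡ 3 × toℕ j ≡ 0))

InducedCopy : ∀ {n k} → (Fin k → Fin k → Set) → Graph n → Set
InducedCopy {n} {k} H G =
  Σ (Fin k → Fin n) λ f → Injective _≡_ _≡_ f × (∀ i j → Adj G (f i) (f j) ⇔ H i j)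

SubgraphCopy : ∀ {n k} → (Fin k → Fin k → Set) → Graph n → Set
SubgraphCopy {n} {k} H G =
  Σ (Fin k → Fin n) λ f → Injective _≡_ _≡_ f × (∀ i j → H i j → Adj G (f i) (f j))

ContainsInducedP : ∀ {n} → ℕ → Graph n → Set
ContainsInducedP k G = InducedCopy (PathAdj {k}) G

ContainsInducedC4 : ∀ {n} → Graph n → Set
ContainsInducedC4 G = InducedCopy C4Adj G

ContainsSubgraphP : ∀ {n} → ℕ → Graph n → Set
ContainsSubgraphP k G = SubgraphCopy (PathAdj {k}) G

module Submission where

-- Let v₀ … v₈ be a copy of P₉ in G.  In a proper 2-colouring the colours
-- alternate along the path, so vᵢ, vⱼ are non-adjacent whenever i − j is
-- even; besides the eight path edges only twelve "chord slots" {i, j} with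
-- j − i ∈ {3, 5, 7} remain undetermined.  Hence the subgraph induced on the
-- path is the pattern `ChordedPath c` determined by the twelve bits c saying
-- which chords are present (`path-reflects`).  A case analysis on c
-- (`obstruction`) shows that every such pattern contains an induced P₇ or
-- C₄: a chord of length 3 closes an induced C₄, the chords of length 5 must
-- then alternate (two consecutive ones close a C₄, two consecutive missing
-- ones leave an induced P₇ of seven consecutive vertices), and the two
-- alternating configurations are settled by one chord of length 7 each.
-- Induced copies compose (`induces-∘`), so the copy inside the pattern is an
-- induced copy in G.  Since adjacency in G need not be decidable, the twelve
-- chords are decided under a double negation, which is harmless because the
-- goal is ⊥.

open import Defs hiding (sym)
open import Data.Nat using (ℕ; parity)
open import Data.Nat.Properties using () renaming (_≟_ to _≟ℕ_)
open import Data.Parity using (Parity; 0ℙ; 1ℙ)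
open import Data.Parity.Properties using () renaming (_≟_ to _≟ℙ_)
open import Data.Bool using (Bool; true; false; not; T; T?)
open import Data.Bool.Properties using (¬-not; not-involutive)
open import Data.Fin using (Fin; zero; suc; toℕ; #_)
open import Data.Fin.Properties using (all?; any?) renaming (_≟_ to _≟ᶠ_)
open import Data.Vec using (Vec; []; _∷_; lookup; tabulate)
open import Data.Vec.Properties using (lookup∘tabulate)
open import Data.Product using (∃; _×_; _,_; proj₁; proj₂)
open import Data.Product.Properties using (≡-dec)
open import Data.Empty using (⊥)
open import Data.Sum as Sum using (_⊎_; inj₁; inj₂)
open import Function using (_∘_; _⇔_; Equivalence; mk⇔)
open import Function.Definitions using (Injective)
open import Function.Construct.Composition using (_⇔-∘_)
open import Function.Construct.Symmetry using (⇔-sym)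
open import Relation.Nullary using (¬_; Dec; yes; no; isYes)
open import Relation.Nullary.Negation using (contradiction)
open import Relation.Nullary.Decidable
  using (True; toWitness; fromWitness; map′; _×-dec_; _⊎-dec_; _→-dec_; ¬¬-excluded-middle)
open import Relation.Binary.PropositionalEquality
  using (_≡_; _≢_; refl; sym; trans; cong; subst; module ≡-Reasoning)

pathAdj? : ∀ {k} (a b : Fin k) → Dec (PathAdj a b)
pathAdj? a b = (toℕ b ≟ℕ ℕ.suc (toℕ a)) ⊎-dec (toℕ a ≟ℕ ℕ.suc (toℕ b))

c4Adj? : (a b : Fin 4) → Dec (C4Adj a b)
c4Adj? a b = pathAdj? a b
  ⊎-dec ((toℕ a ≟ℕ 0) ×-dec (toℕ b ≟ℕ 3)) ⊎-dec ((toℕ a ≟ℕ 3) ×-dec (toℕ b ≟ℕ 0))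

_⇔-dec_ : ∀ {A B : Set} → Dec A → Dec B → Dec (A ⇔ B)
a? ⇔-dec b? = map′ (λ (to , from) → mk⇔ to from)
                   (λ e → Equivalence.to e , Equivalence.from e)
                   ((a? →-dec b?) ×-dec (b? →-dec a?))

-- `t` embeds the pattern H on Fin k into the relation R on Fin m as an
-- induced substructure; for R = Adj G this is literally `InducedCopy H G`.
InducesIn : ∀ {k m} → (Fin k → Fin k → Set) → (Fin m → Fin m → Set)
          → (Fin k → Fin m) → Set
InducesIn H R t = Injective _≡_ _≡_ t × (∀ a b → R (t a) (t b) ⇔ H a b)

induces-∘ : ∀ {k l m} {H : Fin k → Fin k → Set} {R : Fin l → Fin l → Set}
              {S : Fin m → Fin m → Set} {t : Fin k → Fin l} {u : Fin l → Fin m}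
          → InducesIn H R t → InducesIn R S u → InducesIn H S (u ∘ t)
induces-∘ {t = t} (t-inj , t-adj) (u-inj , u-adj) =
  t-inj ∘ u-inj , λ a b → t-adj a b ⇔-∘ u-adj (t a) (t b)

-- Between decidable relations, being an induced embedding is decidable;
-- this lets concrete embeddings be verified by evaluation.
inducesIn? : ∀ {k m} {H : Fin k → Fin k → Set} {R : Fin m → Fin m → Set}
           → (∀ a b → Dec (H a b)) → (∀ x y → Dec (R x y))
           → ∀ t → Dec (InducesIn H R t)
inducesIn? H? R? t = injective? ×-dec all? λ a → all? λ b → R? (t a) (t b) ⇔-dec H? a b
  where
  injective? : Dec (Injective _≡_ _≡_ t)
  injective? = map′ (λ inj {a} {b} → inj a b) (λ inj a b → inj)
                    (all? λ a → all? λ b → (t a ≟ᶠ t b) →-dec (a ≟ᶠ b))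

-- w is a walk in G: consecutive positions are adjacent.  A subgraph copy of
-- P_k is an injective walk.
IsWalk : ∀ {n k} → Graph n → (Fin k → Fin n) → Set
IsWalk G w = ∀ i j → PathAdj i j → Adj G (w i) (w j)

walk-tail : ∀ {n k} (G : Graph n) (w : Fin (ℕ.suc k) → Fin n)
          → IsWalk G w → IsWalk G (w ∘ suc)
walk-tail G w walk i j = walk (suc i) (suc j) ∘ Sum.map (cong ℕ.suc) (cong ℕ.suc)

SameSide : ∀ {k} → Fin k → Fin k → Set
SameSide i j = parity (toℕ i) ≡ parity (toℕ j)

recolour : Parity → Bool → Bool
recolour 0ℙ b = b
recolour 1ℙ b = not b

module _ {n} (G : Graph n) (colour : Fin n → Bool)
         (proper : ∀ {u v} → Adj G u v → colour u ≢ colour v) where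

  -- Along a walk the colour flips at every step, so it is determined by the
  -- parity of the position.
  walk-colour : ∀ {k} (w : Fin (ℕ.suc k) → Fin n) → IsWalk G w
              → ∀ i → colour (w i) ≡ recolour (parity (toℕ i)) (colour (w zero))
  walk-colour w walk zero = refl
  walk-colour w walk (suc zero) = ¬-not (proper (walk (suc zero) zero (inj₂ refl)))
  walk-colour {ℕ.suc (ℕ.suc k)} w walk (suc (suc i)) =
    trans (walk-colour (w ∘ suc ∘ suc) (walk-tail G (w ∘ suc) (walk-tail G w walk)) i)
          (cong (recolour (parity (toℕ i))) two-steps)
    where
    open ≡-Reasoning
    two-steps : colour (w (suc (suc zero))) ≡ colour (w zero)
    two-steps = begin
      colour (w (suc (suc zero)))  ≡⟨ ¬-not (proper (walk _ _ (inj₂ refl))) ⟩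
      not (colour (w (suc zero)))  ≡⟨ cong not (¬-not (proper (walk _ _ (inj₂ refl)))) ⟩
      not (not (colour (w zero)))  ≡⟨ not-involutive _ ⟩
      colour (w zero)              ∎

  same-side-nonadjacent : ∀ {k} (w : Fin (ℕ.suc k) → Fin n) → IsWalk G w
                        → ∀ {i j} → SameSide i j → ¬ Adj G (w i) (w j)
  same-side-nonadjacent w walk {i} {j} same adj = proper adj (begin
    colour (w i)                                         ≡⟨ walk-colour w walk i ⟩
    recolour (parity (toℕ i)) (colour (w zero))          ≡⟨ cong (λ p → recolour p _) same ⟩
    recolour (parity (toℕ j)) (colour (w zero))          ≡⟨ walk-colour w walk j ⟨
    colour (w j)                                         ∎)
    where open ≡-Reasoning

-- The twelve chord slots of P₉: the pairs at odd distance at least 3.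

chordEnds : Vec (Fin 9 × Fin 9) 12
chordEnds = (# 0 , # 3) ∷ (# 1 , # 4) ∷ (# 2 , # 5) ∷ (# 3 , # 6) ∷ (# 4 , # 7) ∷ (# 5 , # 8)
          ∷ (# 0 , # 5) ∷ (# 1 , # 6) ∷ (# 2 , # 7) ∷ (# 3 , # 8)
          ∷ (# 0 , # 7) ∷ (# 1 , # 8) ∷ []

IsSlot : Fin 12 → Fin 9 → Fin 9 → Set
IsSlot k i j = lookup chordEnds k ≡ (i , j) ⊎ lookup chordEnds k ≡ (j , i)

ChordAt : Fin 9 → Fin 9 → Set
ChordAt i j = ∃ λ k → IsSlot k i j

chordAt? : ∀ i j → Dec (ChordAt i j)
chordAt? i j = any? λ k → (lookup chordEnds k ≟² (i , j)) ⊎-dec (lookup chordEnds k ≟² (j , i))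
  where
  _≟²_ : (p q : Fin 9 × Fin 9) → Dec (p ≡ q)
  _≟²_ = ≡-dec _≟ᶠ_ _≟ᶠ_

classify : ∀ i j → PathAdj i j ⊎ ChordAt i j ⊎ SameSide i j
classify = toWitness {a? = all? λ i → all? λ j →
  pathAdj? i j ⊎-dec chordAt? i j ⊎-dec (parity (toℕ i) ≟ℙ parity (toℕ j))} _

slotOrPath : ∀ {i j : Fin 9} → Vec Bool 12 → Dec (ChordAt i j) → Bool
slotOrPath {i} {j} c (yes (k , _)) = lookup c k
slotOrPath {i} {j} c (no _)        = isYes (pathAdj? i j)

-- The graph on P₉ together with the chords selected by c; it is the only
-- possible shape of the subgraph a bipartite graph induces on a copy of P₉.
chordedPath : Vec Bool 12 → Fin 9 → Fin 9 → Bool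
chordedPath c i j = slotOrPath c (chordAt? i j)

ChordedPath : Vec Bool 12 → Fin 9 → Fin 9 → Set
ChordedPath c i j = T (chordedPath c i j)

module _ {n} (G : Graph n) (f : Fin 9 → Fin n) where

  PairAdj : Fin 9 × Fin 9 → Set
  PairAdj p = Adj G (f (proj₁ p)) (f (proj₂ p))

  Chord : Fin 12 → Set
  Chord k = PairAdj (lookup chordEnds k)

  chordBits : (∀ k → Dec (Chord k)) → Vec Bool 12
  chordBits decide = tabulate (isYes ∘ decide)

  chord-adj : ∀ k {i j} → IsSlot k i j → Chord k ⇔ Adj G (f i) (f j)
  chord-adj k (inj₁ ends) = mk⇔ (subst PairAdj ends) (subst PairAdj (sym ends))
  chord-adj k (inj₂ ends) =
    mk⇔ (Graph.sym G ∘ subst PairAdj ends) (subst PairAdj (sym ends) ∘ Graph.sym G)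

  path-reflects : Bipartite G → IsWalk G f → (decide : ∀ k → Dec (Chord k))
                → ∀ i j → Adj G (f i) (f j) ⇔ ChordedPath (chordBits decide) i j
  path-reflects (colour , proper) walk decide i j = by-slot (chordAt? i j)
    where
    by-slot : (slot? : Dec (ChordAt i j))
            → Adj G (f i) (f j) ⇔ T (slotOrPath (chordBits decide) slot?)
    by-slot (yes (k , slot)) rewrite lookup∘tabulate (isYes ∘ decide) k =
      mk⇔ fromWitness toWitness ⇔-∘ ⇔-sym (chord-adj k slot)
    by-slot (no noChord) = by-kind (classify i j)
      where
      by-kind : PathAdj i j ⊎ ChordAt i j ⊎ SameSide i j
              → Adj G (f i) (f j) ⇔ T (isYes (pathAdj? i j))
      by-kind (inj₁ edge)         = mk⇔ (λ _ → fromWitness edge) (λ _ → walk i j edge)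
      by-kind (inj₂ (inj₁ chord)) = contradiction chord noChord
      by-kind (inj₂ (inj₂ same))  = mk⇔ (λ adj → contradiction adj nonadj)
                                        (λ edge → contradiction (walk i j (toWitness edge)) nonadj)
        where
        nonadj : ¬ Adj G (f i) (f j)
        nonadj = same-side-nonadjacent G colour proper f walk same

data Obstruction (c : Vec Bool 12) : Set where
  inducedP7 : ∀ t → InducesIn (PathAdj {7}) (ChordedPath c) t → Obstruction c
  inducedC4 : ∀ t → InducesIn C4Adj (ChordedPath c) t → Obstruction c

path7 : ∀ {c} (vs : Vec (Fin 9) 7)
      → {True (inducesIn? pathAdj? (λ x y → T? (chordedPath c x y)) (lookup vs))}
      → Obstruction c
path7 vs {ok} = inducedP7 (lookup vs) (toWitness ok)

cycle4 : ∀ {c} (vs : Vec (Fin 9) 4)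
       → {True (inducesIn? c4Adj? (λ x y → T? (chordedPath c x y)) (lookup vs))}
       → Obstruction c
cycle4 vs {ok} = inducedC4 (lookup vs) (toWitness ok)

-- Chord bits named by their slots: short chords {i, i+3}, long chords
-- {i, i+5} and the two chords {i, i+7}.
pattern chords s₀ s₁ s₂ s₃ s₄ s₅ l₀ l₁ l₂ l₃ e₀ e₁ =
  s₀ ∷ s₁ ∷ s₂ ∷ s₃ ∷ s₄ ∷ s₅ ∷ l₀ ∷ l₁ ∷ l₂ ∷ l₃ ∷ e₀ ∷ e₁ ∷ []
pattern noShort l₀ l₁ l₂ l₃ e₀ e₁ =
  chords false false false false false false l₀ l₁ l₂ l₃ e₀ e₁

obstruction : ∀ c → Obstruction c
-- a short chord {i, i+3} closes the induced cycle i, i+1, i+2, i+3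
obstruction (chords true _ _ _ _ _ _ _ _ _ _ _) = cycle4 (# 0 ∷ # 1 ∷ # 2 ∷ # 3 ∷ [])
obstruction (chords _ true _ _ _ _ _ _ _ _ _ _) = cycle4 (# 1 ∷ # 2 ∷ # 3 ∷ # 4 ∷ [])
obstruction (chords _ _ true _ _ _ _ _ _ _ _ _) = cycle4 (# 2 ∷ # 3 ∷ # 4 ∷ # 5 ∷ [])
obstruction (chords _ _ _ true _ _ _ _ _ _ _ _) = cycle4 (# 3 ∷ # 4 ∷ # 5 ∷ # 6 ∷ [])
obstruction (chords _ _ _ _ true _ _ _ _ _ _ _) = cycle4 (# 4 ∷ # 5 ∷ # 6 ∷ # 7 ∷ [])
obstruction (chords _ _ _ _ _ true _ _ _ _ _ _) = cycle4 (# 5 ∷ # 6 ∷ # 7 ∷ # 8 ∷ [])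
-- two consecutive missing long chords leave seven consecutive vertices induced
obstruction (noShort false false _ _ _ _) = path7 (# 0 ∷ # 1 ∷ # 2 ∷ # 3 ∷ # 4 ∷ # 5 ∷ # 6 ∷ [])
obstruction (noShort _ false false _ _ _) = path7 (# 1 ∷ # 2 ∷ # 3 ∷ # 4 ∷ # 5 ∷ # 6 ∷ # 7 ∷ [])
obstruction (noShort _ _ false false _ _) = path7 (# 2 ∷ # 3 ∷ # 4 ∷ # 5 ∷ # 6 ∷ # 7 ∷ # 8 ∷ [])
-- two consecutive long chords {i, i+5}, {i+1, i+6} close a C₄
obstruction (noShort true true _ _ _ _) = cycle4 (# 0 ∷ # 1 ∷ # 6 ∷ # 5 ∷ [])
obstruction (noShort _ true true _ _ _) = cycle4 (# 1 ∷ # 2 ∷ # 7 ∷ # 6 ∷ [])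
obstruction (noShort _ _ true true _ _) = cycle4 (# 2 ∷ # 3 ∷ # 8 ∷ # 7 ∷ [])
-- long chords {0,5}, {2,7}: decided by the chord {0,7}
obstruction (noShort true false true false true _)  = cycle4 (# 0 ∷ # 5 ∷ # 6 ∷ # 7 ∷ [])
obstruction (noShort true false true false false _) = path7 (# 0 ∷ # 5 ∷ # 4 ∷ # 3 ∷ # 2 ∷ # 7 ∷ # 8 ∷ [])
-- long chords {1,6}, {3,8}: decided by the chord {1,8}
obstruction (noShort false true false true _ true)  = cycle4 (# 1 ∷ # 2 ∷ # 3 ∷ # 8 ∷ [])
obstruction (noShort false true false true _ false) = path7 (# 0 ∷ # 1 ∷ # 6 ∷ # 5 ∷ # 4 ∷ # 3 ∷ # 8 ∷ [])

¬¬-decide-all : ∀ {k} {P : Fin k → Set} → ¬ ¬ (∀ i → Dec (P i))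
¬¬-decide-all {ℕ.zero} give-up = give-up λ ()
¬¬-decide-all {ℕ.suc k} {P} give-up =
  ¬¬-excluded-middle λ d₀ → ¬¬-decide-all {k} {P ∘ suc} λ ds →
    give-up λ { zero → d₀ ; (suc i) → ds i }

mainTheorem12 : ∀ (n : ℕ) (G : Graph n) → Bipartite G
                  → ¬ ContainsInducedP 7 G → ¬ ContainsInducedC4 G
                  → ¬ ContainsSubgraphP 9 G
mainTheorem12 n G bipartite noP7 noC4 (f , f-inj , walk) =
  ¬¬-decide-all λ decide →
    let c = chordBits G f decide
        onPath : InducesIn (ChordedPath c) (Adj G) f
        onPath = f-inj , path-reflects G f bipartite walk decide
    in  refute onPath (obstruction c)
  where
  refute : ∀ {c} → InducesIn (ChordedPath c) (Adj G) f → Obstruction c → ⊥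
  refute onPath (inducedP7 t t-ind) = noP7 (f ∘ t , induces-∘ {S = Adj G} t-ind onPath)
  refute onPath (inducedC4 t t-ind) = noC4 (f ∘ t , induces-∘ {S = Adj G} t-ind onPath)
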